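{- Let $p \in (0,1)$, let $\mathbf{X} \in \{0,1\}^n$ be drawn uniformly at random, and let $(\mathbf{t}, \widetilde{\mathbf{X}}) \sim \mathcal{D}^*_p(\mathbf{X})$. Then for any integer $k \ge 1$, conditioned on the event $|\mathbf{t}| \ge k$ and on the values of $t_1, \ldots, t_k$ and $g_1(\widetilde{\mathbf{X}}, \mathbf{X}), \ldots, g_k(\widetilde{\mathbf{X}}, \mathbf{X})$, the bits $X_{g_k(\widetilde{\mathbf{X}}, \mathbf{X}) + 1}, X_{g_k(\widetilde{\mathbf{X}}, \mathbf{X}) + 2}, \ldots, X_n$ are i.i.d. uniformly distributed on $\{0,1\}$.
   Context: For $\mathbf{x} \in \{0,1\}^n$ and $p \in (0,1)$, $\mathcal{D}^*_p(\mathbf{x})$ is the distribution of the pair $(\mathbf{t}, \widetilde{\mathbf{x}})$ obtained as follows: each index $i \in \{1,\ldots,n\}$ is independently retained with probability $p$ (deleted with probability $1-p$); $\mathbf{t} = (t_1 < t_2 < \cdots < t_m)$ is the increasing list of retained indices (so $m = |\mathbf{t}|$ is random), and $\widetilde{\mathbf{x}} = (\widetilde{x}_1, \ldots, \widetilde{x}_m)$ with $\widetilde{x}_i = x_{t_i}$. For bit strings $\mathbf{x}, \mathbf{y}$, the greedy matching indices $g_k(\mathbf{y}, \mathbf{x})$, $1 \le k \le |\mathbf{y}|$, are defined by: $g_1(\mathbf{y},\mathbf{x})$ is the least index $i$ with $x_i = y_1$ (or $\infty$ if none exists); for $k < |\mathbf{y}|$, $g_{k+1}(\mathbf{y},\mathbf{x})$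 is the least index $i > g_k(\mathbf{y},\mathbf{x})$ with $x_i = y_{k+1}$ (or $\infty$ if none exists, in particular if $g_k(\mathbf{y},\mathbf{x}) = \infty$). When $\widetilde{\mathbf{x}}$ is a trace of $\mathbf{x}$ one has $g_k(\widetilde{\mathbf{x}}, \mathbf{x}) \le t_k < \infty$.
   Formalization: The parameter p ranges only over the rational numbers in $(0,1)$. -}

module Defs where

open import Data.Bool using (Bool; true; false; if_then_else_)
open import Data.Bool.Properties using () renaming (_≟_ to _≟ᵇ_)
open import Data.Nat using (ℕ; zero; suc; _≤_; _≤?_)
open import Data.Nat.Properties using () renaming (_≟_ to _≟ℕ_)
open import Data.Maybe using (Maybe; just; nothing)
import Data.Maybe.Properties as MaybeP
open import Data.List using (List; []; _∷_; length; take; drop; map; concatMap; foldr)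
import Data.List.Properties as ListP
open import Data.Vec using (Vec; toList)
import Data.Vec as Vec
open import Data.Product using (_×_; _,_)
open import Data.Rational using (ℚ; 0ℚ; 1ℚ; ½; _+_; _*_; _-_)
open import Relation.Binary.PropositionalEquality using (_≡_)
open import Relation.Nullary using (Dec; yes; no; does; _×-dec_)

-- Bit strings are lists/vectors of Bool; indices are 1-based naturals.
-- ∞ (no match) is represented by 'nothing'.

retainedFrom : ℕ → List Bool → List ℕ
retainedFrom i []            = []
retainedFrom i (true  ∷ r)   = i ∷ retainedFrom (suc i) r
retainedFrom i (false ∷ r)   = retainedFrom (suc i) r

tIdx : List Bool → List ℕ
tIdx r = retainedFrom 1 r

traceBits : List Bool → List Bool → List Bool
traceBits []       _           = []
traceBits (x ∷ xs) []          = []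
traceBits (x ∷ xs) (true ∷ r)  = x ∷ traceBits xs r
traceBits (x ∷ xs) (false ∷ r) = traceBits xs r

scan : ℕ → Bool → List Bool → Maybe ℕ
scan i b []       = nothing
scan i b (c ∷ cs) = if does (c ≟ᵇ b) then just i else scan (suc i) b cs

firstAfter : ℕ → Bool → List Bool → Maybe ℕ
firstAfter j b x = scan (suc j) b (drop j x)

greedyFrom : Maybe ℕ → List Bool → List Bool → List (Maybe ℕ)
greedyFrom prev     []      x = []
greedyFrom nothing  (b ∷ y) x = nothing ∷ greedyFrom nothing y x
greedyFrom (just j) (b ∷ y) x = let m = firstAfter j b x in m ∷ greedyFrom m y x

g : List Bool → List Bool → List (Maybe ℕ)
g y x = greedyFrom (just 0) y x

-- Probability space: X uniform in {0,1}^n, mask r with independent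
-- Bernoulli(p) coordinates (r_i = true iff index i is retained),
-- X and r independent.

allVecs : (n : ℕ) → List (Vec Bool n)
allVecs zero    = Vec.[] ∷ []
allVecs (suc n) = concatMap (λ v → (true Vec.∷ v) ∷ (false Vec.∷ v) ∷ []) (allVecs n)

sumℚ : List ℚ → ℚ
sumℚ = foldr _+_ 0ℚ

weight : (p : ℚ) → {n : ℕ} → Vec Bool n → Vec Bool n → ℚ
weight p Vec.[]       Vec.[]           = 1ℚ
weight p (x Vec.∷ xs) (ri Vec.∷ r) = (½ * (if ri then p else 1ℚ - p)) * weight p xs r

Pr : (p : ℚ) (n : ℕ) (E : Vec Bool n → Vec Bool n → Set) →
     (∀ x r → Dec (E x r)) → ℚ
Pr p n E E? = sumℚ (concatMap (λ x → map (λ r → if does (E? x r) then weight p x r else 0ℚ)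
                                        (allVecs n))
                              (allVecs n))

Cond : {n k : ℕ} → Vec ℕ k → Vec ℕ k → Vec Bool n → Vec Bool n → Set
Cond {k = k} τ γ x r =
  (k ≤ length (tIdx (toList r))) ×
  (take k (tIdx (toList r)) ≡ toList τ) ×
  (take k (g (traceBits (toList x) (toList r)) (toList x)) ≡ map just (toList γ))

Cond? : {n k : ℕ} (τ γ : Vec ℕ k) → ∀ x r → Dec (Cond {n} τ γ x r)
Cond? {k = k} τ γ x r =
  (k ≤? length (tIdx (toList r))) ×-dec
  (ListP.≡-dec _≟ℕ_ (take k (tIdx (toList r))) (toList τ) ×-dec
   ListP.≡-dec (MaybeP.≡-dec _≟ℕ_) (take k (g (traceBits (toList x) (toList r)) (toList x)))
                                   (map just (toList γ)))

CondSuffix : {n k : ℕ} → Vec ℕ k → Vec ℕ k → ℕ → List Bool →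
             Vec Bool n → Vec Bool n → Set
CondSuffix τ γ gk s x r = Cond τ γ x r × (drop gk (toList x) ≡ s)

CondSuffix? : {n k : ℕ} (τ γ : Vec ℕ k) (gk : ℕ) (s : List Bool) →
              ∀ x r → Dec (CondSuffix {n} τ γ gk s x r)
CondSuffix? τ γ gk s x r = Cond? τ γ x r ×-dec ListP.≡-dec _≟ᵇ_ (drop gk (toList x)) s

halfPow : ℕ → ℚ
halfPow zero    = 1ℚ
halfPow (suc m) = ½ * halfPow m

-- Fix the conditioning values τ, γ and a position i₀ beyond L = γₖ. Toggling X on a mask M
-- is a measure-preserving involution of (X, r); we choose M so that it preserves the
-- conditioning event, leaves X unchanged at the positions in (L, i₀), and flips X at i₀.
-- Hence, given the event and the earlier suffix bits, the bit at i₀ is a fair coin, and the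
-- claim follows one suffix bit at a time. The mask is 1 at i₀, 0 elsewhere beyond L, and on
-- each block (γᵢ₋₁, γᵢ] it is constant, equal to its value at tᵢ. Then the trace bit
-- X̃ᵢ = X_{tᵢ} is toggled exactly when the block in which the greedy matching looks for it
-- is, so the greedy indices do not move. Such a mask exists because γᵢ ≤ tᵢ.

module Submission where

open import Defs
open import Algebra.Bundles using (CommutativeMonoid)
open import Data.Bool using (Bool; true; false; not; _∧_; _xor_; if_then_else_)
open import Data.Bool.Properties
  using (xor-assoc; xor-same; xor-identityʳ; xor-comm; not-involutive; if-eta)
  renaming (_≟_ to _≟ᵇ_)
open import Data.Empty using (⊥; ⊥-elim)
open import Data.List using (List; []; _∷_; _++_; _∷ʳ_; map; concatMap; take; drop; length; zipWith)
import Data.List.Properties as List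
open import Data.List.Relation.Binary.Prefix.Heterogeneous as Prefix using (Prefix; []; _∷_)
open import Data.List.Relation.Unary.All as All using (All; []; _∷_)
open import Data.List.Relation.Unary.Linked as Linked using (Linked; [-]; _∷_)
open import Data.Maybe using (just)
open import Data.Maybe.Properties using (just-injective)
open import Data.Nat using (ℕ; zero; suc; _+_; _∸_; _≤_; _<_; _≤?_; z≤n; s≤s)
open import Data.Nat.Properties
  using (≤-refl; ≤-trans; ≤-reflexive; ≤-<-trans; <-≤-trans; <-trans; <⇒≤; <⇒≱; n≤1+n;
         <-irrefl; m≤n+m; m+1+n≰m; +-suc; +-identityʳ; +-cancelʳ-≡)
  renaming (_≟_ to _≟ℕ_)
open import Data.Product using (_×_; _,_; proj₁; proj₂)
open import Data.Rational using (ℚ; 0ℚ; 1ℚ; ½; _*_; _-_) renaming (_+_ to _+ℚ_; _<_ to _<ℚ_)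
import Data.Rational.Properties as ℚ
open import Data.Unit using (⊤; tt)
open import Data.Vec using (Vec; toList; last)
import Data.Vec as Vec
open import Data.Vec.Properties using (length-toList)
open import Function.Bundles using (_⇔_; mk⇔; Equivalence)
open import Relation.Binary.PropositionalEquality
open import Relation.Nullary using (Dec; does; _×-dec_)
open import Relation.Nullary.Decidable using (dec-true; dec-false; does-⇔)

open import Algebra.Properties.CommutativeSemigroup
  (CommutativeMonoid.commutativeSemigroup ℚ.+-0-commutativeMonoid) using (interchange)
open Equivalence using (to; from)

-- Toggling X on a mask

toggle : (ℕ → Bool) → ℕ → List Bool → List Bool
toggle M i []       = []
toggle M i (b ∷ bs) = (b xor M i) ∷ toggle M (suc i) bs

toggleᵛ : (ℕ → Bool) → ℕ → ∀ {n} → Vec Bool n → Vec Bool n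
toggleᵛ M i Vec.[]       = Vec.[]
toggleᵛ M i (b Vec.∷ bs) = (b xor M i) Vec.∷ toggleᵛ M (suc i) bs

toList-toggleᵛ : ∀ M i {n} (x : Vec Bool n) → toList (toggleᵛ M i x) ≡ toggle M i (toList x)
toList-toggleᵛ M i Vec.[]       = refl
toList-toggleᵛ M i (b Vec.∷ x) = cong (_ ∷_) (toList-toggleᵛ M (suc i) x)

xor-xor-cancel : ∀ a c → (a xor c) xor c ≡ a
xor-xor-cancel a c = trans (xor-assoc a c c) (trans (cong (a xor_) (xor-same c)) (xor-identityʳ a))

toggleᵛ-involutive : ∀ M i {n} (x : Vec Bool n) → toggleᵛ M i (toggleᵛ M i x) ≡ x
toggleᵛ-involutive M i Vec.[]       = refl
toggleᵛ-involutive M i (b Vec.∷ x) =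
  cong₂ Vec._∷_ (xor-xor-cancel b (M i)) (toggleᵛ-involutive M (suc i) x)

weight-toggleᵛ : ∀ p M i {n} (x r : Vec Bool n) → weight p (toggleᵛ M i x) r ≡ weight p x r
weight-toggleᵛ p M i Vec.[]       Vec.[]       = refl
weight-toggleᵛ p M i (b Vec.∷ x) (c Vec.∷ r) =
  cong ((½ * (if c then p else 1ℚ - p)) *_) (weight-toggleᵛ p M (suc i) x r)

drop-toggle : ∀ M d i xs → drop d (toggle M i xs) ≡ toggle M (i + d) (drop d xs)
drop-toggle M zero    i xs       rewrite +-identityʳ i = refl
drop-toggle M (suc d) i []       = refl
drop-toggle M (suc d) i (x ∷ xs) rewrite +-suc i d = drop-toggle M d (suc i) xs

take-toggle : ∀ M j i xs → (∀ d → d < j → M (d + i) ≡ false) → take j (toggle M i xs) ≡ take j xs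
take-toggle M zero    i xs       off = refl
take-toggle M (suc j) i []       off = refl
take-toggle M (suc j) i (x ∷ xs) off =
  cong₂ _∷_ (trans (cong (x xor_) (off 0 (s≤s z≤n))) (xor-identityʳ x))
            (take-toggle M j (suc i) xs (λ d d<j → trans (cong M (+-suc d i)) (off (suc d) (s≤s d<j))))

traceBits-toggle : ∀ M i xs R →
  traceBits (toggle M i xs) R ≡ zipWith _xor_ (traceBits xs R) (map M (retainedFrom i R))
traceBits-toggle M i []       R           = refl
traceBits-toggle M i (x ∷ xs) []          = refl
traceBits-toggle M i (x ∷ xs) (true  ∷ R) = cong (_ ∷_) (traceBits-toggle M (suc i) xs R)
traceBits-toggle M i (x ∷ xs) (false ∷ R) = traceBits-toggle M (suc i) xs R

-- bitAt j l is false when l has no j-th bit.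
bitAt : ℕ → List Bool → Bool
bitAt j       []       = false
bitAt zero    (b ∷ bs) = b
bitAt (suc j) (b ∷ bs) = bitAt j bs

bitAt-toggle : ∀ M j i xs → j < length xs → bitAt j (toggle M i xs) ≡ bitAt j xs xor M (j + i)
bitAt-toggle M zero    i (x ∷ xs) _         = refl
bitAt-toggle M (suc j) i (x ∷ xs) (s≤s j<) rewrite bitAt-toggle M j (suc i) xs j< | +-suc j i = refl

take-suc-bitAt : ∀ j (l : List Bool) → j < length l → take (suc j) l ≡ take j l ∷ʳ bitAt j l
take-suc-bitAt zero    (x ∷ l) _          = refl
take-suc-bitAt (suc j) (x ∷ l) (s≤s j<l) = cong (x ∷_) (take-suc-bitAt j l j<l)

take-suc-≡ : ∀ j (l l′ : List Bool) → j < length l → j < length l′ →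
             take (suc j) l ≡ take (suc j) l′ ⇔ (take j l ≡ take j l′ × bitAt j l ≡ bitAt j l′)
take-suc-≡ j l l′ j<l j<l′ = mk⇔
  (λ eq → List.∷ʳ-injective _ _ (trans (sym (unfold j<l)) (trans eq (unfold j<l′))))
  (λ (eq₁ , eq₂) → trans (unfold j<l) (trans (cong₂ _∷ʳ_ eq₁ eq₂) (sym (unfold j<l′))))
  where
  unfold : ∀ {l} → j < length l → take (suc j) l ≡ take j l ∷ʳ bitAt j l
  unfold = take-suc-bitAt j _

does-xor-≟ : ∀ a b c → does ((a xor c) ≟ᵇ (b xor c)) ≡ does (a ≟ᵇ b)
does-xor-≟ a b c = does-⇔ (mk⇔ cancel (cong (_xor c))) ((a xor c) ≟ᵇ (b xor c)) (a ≟ᵇ b)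
  where
  cancel : a xor c ≡ b xor c → a ≡ b
  cancel eq = trans (sym (xor-xor-cancel a c)) (trans (cong (_xor c) eq) (xor-xor-cancel b c))

scan-≥ : ∀ i b xs {q} → scan i b xs ≡ just q → i ≤ q
scan-≥ i b (x ∷ xs) found with does (x ≟ᵇ b)
... | true  = ≤-reflexive (just-injective found)
... | false = ≤-trans (n≤1+n i) (scan-≥ (suc i) b xs found)

scan-toggle : ∀ M c i b xs {q} → scan i b xs ≡ just q → (∀ p → i ≤ p → p ≤ q → M p ≡ c) →
              scan i (b xor c) (toggle M i xs) ≡ just q
scan-toggle M c i b (x ∷ xs) found constant
  rewrite constant i ≤-refl (scan-≥ i b (x ∷ xs) found) | does-xor-≟ x b c with does (x ≟ᵇ b)
... | true  = found
... | false = scan-toggle M c (suc i) b xs found (λ p i<p → constant p (<⇒≤ i<p))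

firstAfter-toggle : ∀ M c j b X {q} → firstAfter j b X ≡ just q →
                    (∀ p → j < p → p ≤ q → M p ≡ c) → firstAfter j (b xor c) (toggle M 1 X) ≡ just q
firstAfter-toggle M c j b X found constant
  rewrite drop-toggle M j 1 X = scan-toggle M c (suc j) b (drop j X) found constant

-- Sums and probabilities

sumℚ-++ : ∀ xs ys → sumℚ (xs ++ ys) ≡ sumℚ xs +ℚ sumℚ ys
sumℚ-++ []       ys = sym (ℚ.+-identityˡ _)
sumℚ-++ (x ∷ xs) ys = trans (cong (x +ℚ_) (sumℚ-++ xs ys)) (sym (ℚ.+-assoc x _ _))

sumℚ-concatMap : ∀ {A : Set} (h : A → List ℚ) xs →
                 sumℚ (concatMap h xs) ≡ sumℚ (map (λ a → sumℚ (h a)) xs)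
sumℚ-concatMap h []       = refl
sumℚ-concatMap h (x ∷ xs) =
  trans (sumℚ-++ (h x) (concatMap h xs)) (cong (sumℚ (h x) +ℚ_) (sumℚ-concatMap h xs))

sumℚ-map-+ : ∀ {A : Set} (f h : A → ℚ) xs →
             sumℚ (map f xs) +ℚ sumℚ (map h xs) ≡ sumℚ (map (λ a → f a +ℚ h a) xs)
sumℚ-map-+ f h []       = ℚ.+-identityˡ 0ℚ
sumℚ-map-+ f h (x ∷ xs) =
  trans (interchange (f x) _ (h x) _) (cong (f x +ℚ h x +ℚ_) (sumℚ-map-+ f h xs))

sumAll : (n : ℕ) → (Vec Bool n → ℚ) → ℚ
sumAll n h = sumℚ (map h (allVecs n))

sumAll-cong : ∀ n {h h′ : Vec Bool n → ℚ} → (∀ v → h v ≡ h′ v) → sumAll n h ≡ sumAll n h′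
sumAll-cong n eq = cong sumℚ (List.map-cong eq (allVecs n))

sumAll-+ : ∀ n (h h′ : Vec Bool n → ℚ) →
           sumAll n h +ℚ sumAll n h′ ≡ sumAll n (λ v → h v +ℚ h′ v)
sumAll-+ n h h′ = sumℚ-map-+ h h′ (allVecs n)

sumAll-suc : ∀ n (h : Vec Bool (suc n) → ℚ) →
             sumAll (suc n) h ≡ sumAll n (λ v → h (true Vec.∷ v) +ℚ h (false Vec.∷ v))
sumAll-suc n h = begin
  sumℚ (map h (concatMap (λ v → (true Vec.∷ v) ∷ (false Vec.∷ v) ∷ []) (allVecs n)))
    ≡⟨ cong sumℚ (List.map-concatMap h _ (allVecs n)) ⟩
  sumℚ (concatMap (λ v → h (true Vec.∷ v) ∷ h (false Vec.∷ v) ∷ []) (allVecs n))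
    ≡⟨ sumℚ-concatMap _ (allVecs n) ⟩
  sumAll n (λ v → h (true Vec.∷ v) +ℚ (h (false Vec.∷ v) +ℚ 0ℚ))
    ≡⟨ sumAll-cong n (λ v → cong (h (true Vec.∷ v) +ℚ_) (ℚ.+-identityʳ _)) ⟩
  sumAll n (λ v → h (true Vec.∷ v) +ℚ h (false Vec.∷ v)) ∎
  where open ≡-Reasoning

mass : ∀ (p : ℚ) {n} {E : Vec Bool n → Vec Bool n → Set} → (∀ x r → Dec (E x r)) →
       Vec Bool n → Vec Bool n → ℚ
mass p E? x r = if does (E? x r) then weight p x r else 0ℚ

Pr-sumAll : ∀ p n {E : Vec Bool n → Vec Bool n → Set} (E? : ∀ x r → Dec (E x r)) →
            Pr p n E E? ≡ sumAll n (λ x → sumAll n (mass p E? x))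
Pr-sumAll p n E? = sumℚ-concatMap _ (allVecs n)

sumAll-toggleᵛ : ∀ M n i (h : Vec Bool n → ℚ) → sumAll n h ≡ sumAll n (λ v → h (toggleᵛ M i v))
sumAll-toggleᵛ M zero    i h = refl
sumAll-toggleᵛ M (suc n) i h = begin
  sumAll (suc n) h
    ≡⟨ sumAll-suc n h ⟩
  sumAll n (λ v → h (true Vec.∷ v) +ℚ h (false Vec.∷ v))
    ≡⟨ sumAll-toggleᵛ M n (suc i) _ ⟩
  sumAll n (λ v → h (true Vec.∷ toggleᵛ M (suc i) v) +ℚ h (false Vec.∷ toggleᵛ M (suc i) v))
    ≡⟨ sumAll-cong n (λ v → swap (M i) (λ b → h (b Vec.∷ toggleᵛ M (suc i) v))) ⟩
  sumAll n (λ v → h (toggleᵛ M i (true Vec.∷ v)) +ℚ h (toggleᵛ M i (false Vec.∷ v)))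
    ≡⟨ sumAll-suc n (λ v → h (toggleᵛ M i v)) ⟨
  sumAll (suc n) (λ v → h (toggleᵛ M i v)) ∎
  where
  open ≡-Reasoning
  swap : ∀ c (f : Bool → ℚ) → f true +ℚ f false ≡ f (true xor c) +ℚ f (false xor c)
  swap false f = refl
  swap true  f = ℚ.+-comm (f true) (f false)

module _ {p : ℚ} {n : ℕ} where

  Pr-cong : ∀ {E F : Vec Bool n → Vec Bool n → Set} E? F? →
            (∀ x r → E x r ⇔ F x r) → Pr p n E E? ≡ Pr p n F F?
  Pr-cong E? F? E⇔F = cong sumℚ (List.concatMap-cong (λ x → List.map-cong (λ r →
      cong (if_then weight p x r else 0ℚ) (does-⇔ (E⇔F x r) (E? x r) (F? x r)))
    (allVecs n)) (allVecs n))

  Pr-split : ∀ {E : Vec Bool n → Vec Bool n → Set} E? (β : Vec Bool n → Bool) b →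
    Pr p n E E? ≡ Pr p n (λ x r → E x r × β x ≡ b) (λ x r → E? x r ×-dec (β x ≟ᵇ b))
             +ℚ Pr p n (λ x r → E x r × β x ≡ not b) (λ x r → E? x r ×-dec (β x ≟ᵇ not b))
  Pr-split {E} E? β b = begin
    Pr p n _ E?
      ≡⟨ Pr-sumAll p n E? ⟩
    sumAll n (λ x → sumAll n (mass p E? x))
      ≡⟨ sumAll-cong n (λ x → trans (sumAll-cong n (λ r → split (does (E? x r)) (β x) b (weight p x r)))
                                    (sym (sumAll-+ n _ _))) ⟩
    sumAll n (λ x → sumAll n (mass p E?∧β≡b x) +ℚ sumAll n (mass p E?∧β≡¬b x))
      ≡⟨ sumAll-+ n _ _ ⟨
    sumAll n (λ x → sumAll n (mass p E?∧β≡b x)) +ℚ sumAll n (λ x → sumAll n (mass p E?∧β≡¬b x))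
      ≡⟨ cong₂ _+ℚ_ (Pr-sumAll p n E?∧β≡b) (Pr-sumAll p n E?∧β≡¬b) ⟨
    _ ∎
    where
    open ≡-Reasoning
    E?∧β≡b : ∀ x r → Dec (E x r × β x ≡ b)
    E?∧β≡b x r = E? x r ×-dec (β x ≟ᵇ b)
    E?∧β≡¬b : ∀ x r → Dec (E x r × β x ≡ not b)
    E?∧β≡¬b x r = E? x r ×-dec (β x ≟ᵇ not b)
    split : ∀ e c b (w : ℚ) → (if e then w else 0ℚ)
          ≡ (if e ∧ does (c ≟ᵇ b) then w else 0ℚ) +ℚ (if e ∧ does (c ≟ᵇ not b) then w else 0ℚ)
    split false c     b     w = sym (ℚ.+-identityˡ 0ℚ)
    split true  true  true  w = sym (ℚ.+-identityʳ w)
    split true  true  false w = sym (ℚ.+-identityˡ w)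
    split true  false true  w = sym (ℚ.+-identityˡ w)
    split true  false false w = sym (ℚ.+-identityʳ w)

  Pr-toggle : ∀ M {E : Vec Bool n → Vec Bool n → Set} E? →
    Pr p n E E? ≡ Pr p n (λ x r → E (toggleᵛ M 1 x) r) (λ x r → E? (toggleᵛ M 1 x) r)
  Pr-toggle M E? = begin
    Pr p n _ E?
      ≡⟨ Pr-sumAll p n E? ⟩
    sumAll n (λ x → sumAll n (mass p E? x))
      ≡⟨ sumAll-toggleᵛ M n 1 _ ⟩
    sumAll n (λ x → sumAll n (mass p E? (toggleᵛ M 1 x)))
      ≡⟨ sumAll-cong n (λ x → sumAll-cong n (λ r →
           cong (if does (E? (toggleᵛ M 1 x) r) then_else 0ℚ) (weight-toggleᵛ p M 1 x r))) ⟩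
    sumAll n (λ x → sumAll n (mass p (λ x r → E? (toggleᵛ M 1 x) r) x))
      ≡⟨ Pr-sumAll p n (λ x r → E? (toggleᵛ M 1 x) r) ⟨
    _ ∎
    where open ≡-Reasoning

  Pr-fair-bit : ∀ M {E : Vec Bool n → Vec Bool n → Set} E? (β : Vec Bool n → Bool) b →
    (∀ {x r} → E x r → E (toggleᵛ M 1 x) r) →
    (∀ {x r} → E x r → β (toggleᵛ M 1 x) ≡ not (β x)) →
    Pr p n (λ x r → E x r × β x ≡ b) (λ x r → E? x r ×-dec (β x ≟ᵇ b)) ≡ ½ * Pr p n E E?
  Pr-fair-bit M {E} E? β b preserves flips = begin
    A                ≡⟨ half A ⟨
    ½ * (A +ℚ A)     ≡⟨ cong (λ B → ½ * (A +ℚ B)) A≡B ⟩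
    ½ * (A +ℚ B)     ≡⟨ cong (½ *_) (Pr-split E? β b) ⟨
    ½ * Pr p n E E?  ∎
    where
    open ≡-Reasoning
    E∧β≡b? : ∀ x r → Dec (E x r × β x ≡ b)
    E∧β≡b? x r = E? x r ×-dec (β x ≟ᵇ b)
    E∧β≡¬b? : ∀ x r → Dec (E x r × β x ≡ not b)
    E∧β≡¬b? x r = E? x r ×-dec (β x ≟ᵇ not b)
    A = Pr p n (λ x r → E x r × β x ≡ b) E∧β≡b?
    B = Pr p n (λ x r → E x r × β x ≡ not b) E∧β≡¬b?
    half : ∀ a → ½ * (a +ℚ a) ≡ a
    half a = trans (ℚ.*-distribˡ-+ ½ a a) (trans (sym (ℚ.*-distribʳ-+ a ½ ½)) (ℚ.*-identityˡ a))
    toggled⇒ : ∀ {x r} → E (toggleᵛ M 1 x) r × β (toggleᵛ M 1 x) ≡ b → E x r × β x ≡ not b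
    toggled⇒ {x} {r} (e , β≡b) =
      subst (λ z → E z r) (toggleᵛ-involutive M 1 x) (preserves e) ,
      trans (cong β (sym (toggleᵛ-involutive M 1 x))) (trans (flips e) (cong not β≡b))
    ⇒toggled : ∀ {x r} → E x r × β x ≡ not b → E (toggleᵛ M 1 x) r × β (toggleᵛ M 1 x) ≡ b
    ⇒toggled (e , β≡¬b) = preserves e , trans (flips e) (trans (cong not β≡¬b) (not-involutive b))
    A≡B : A ≡ B
    A≡B = trans (Pr-toggle M E∧β≡b?)
                (Pr-cong (λ x r → E∧β≡b? (toggleᵛ M 1 x) r) E∧β≡¬b? (λ _ _ → mk⇔ toggled⇒ ⇒toggled))

-- Greedy matching

-- BitAt i xs t b: reading xs from index i on, the bit at index t is b.
data BitAt : ℕ → List Bool → ℕ → Bool → Set where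
  here  : ∀ {i b xs}     → BitAt i (b ∷ xs) i b
  there : ∀ {i t b x xs} → BitAt (suc i) xs t b → BitAt i (x ∷ xs) t b

BitAt-≥ : ∀ {i xs t b} → BitAt i xs t b → i ≤ t
BitAt-≥ here      = ≤-refl
BitAt-≥ (there a) = <⇒≤ (BitAt-≥ a)

BitAt-drop : ∀ {i xs t b} j → BitAt i xs t b → i + j ≤ t → BitAt (i + j) (drop j xs) t b
BitAt-drop {i} zero    a         _ rewrite +-identityʳ i = a
BitAt-drop {i} (suc j) here      i+j<i = ⊥-elim (m+1+n≰m i i+j<i)
BitAt-drop {i} (suc j) (there a) i+j<t rewrite +-suc i j = BitAt-drop j a i+j<t

scan-least : ∀ i b xs {q t} → scan i b xs ≡ just q → BitAt i xs t b → q ≤ t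
scan-least i b (b ∷ xs) found here rewrite dec-true (b ≟ᵇ b) refl =
  ≤-reflexive (sym (just-injective found))
scan-least i b (x ∷ xs) found (there a) with does (x ≟ᵇ b)
... | true  = ≤-trans (≤-reflexive (sym (just-injective found))) (<⇒≤ (BitAt-≥ a))
... | false = scan-least (suc i) b xs found a

firstAfter-least : ∀ j b X {q t} → firstAfter j b X ≡ just q → BitAt 1 X t b → j < t → q ≤ t
firstAfter-least j b X found a j<t = scan-least (suc j) b (drop j X) found (BitAt-drop j a j<t)

trace-BitAt : ∀ i xs R → Prefix (λ b t → BitAt i xs t b) (traceBits xs R) (retainedFrom i R)
trace-BitAt i []       R           = []
trace-BitAt i (x ∷ xs) []          = []
trace-BitAt i (x ∷ xs) (true  ∷ R) = here ∷ Prefix.map there (trace-BitAt (suc i) xs R)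
trace-BitAt i (x ∷ xs) (false ∷ R) = Prefix.map there (trace-BitAt (suc i) xs R)

Linked-<-lowerHead : ∀ {a b xs} → a ≤ b → Linked _<_ (b ∷ xs) → Linked _<_ (a ∷ xs)
Linked-<-lowerHead a≤b [-]           = [-]
Linked-<-lowerHead a≤b (b<c ∷ linked) = ≤-<-trans a≤b b<c ∷ linked

retained-ascending : ∀ i R → Linked _<_ (i ∷ retainedFrom (suc i) R)
retained-ascending i []          = [-]
retained-ascending i (true  ∷ R) = ≤-refl ∷ retained-ascending (suc i) R
retained-ascending i (false ∷ R) = Linked-<-lowerHead (n≤1+n i) (retained-ascending (suc i) R)

Matches : List Bool → ℕ → List Bool → List ℕ → Set
Matches X j y       []       = ⊤
Matches X j []      (γ ∷ γs) = ⊥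
Matches X j (b ∷ y) (γ ∷ γs) = firstAfter j b X ≡ just γ × Matches X γ y γs

take-greedy⇔Matches : ∀ {k} (γ : Vec ℕ k) j y X →
  take k (greedyFrom (just j) y X) ≡ map just (toList γ) ⇔ Matches X j y (toList γ)
take-greedy⇔Matches Vec.[]       j y       X = mk⇔ (λ _ → tt) (λ _ → refl)
take-greedy⇔Matches (γ Vec.∷ γs) j []      X = mk⇔ (λ ()) (λ ())
take-greedy⇔Matches (γ Vec.∷ γs) j (b ∷ y) X = mk⇔
  (λ eq → let found , rest = List.∷-injective eq in
    found , to (take-greedy⇔Matches γs γ y X)
                (subst (λ m → take _ (greedyFrom m y X) ≡ _) found rest))
  (λ (found , matches) → cong₂ _∷_ found
    (subst (λ m → take _ (greedyFrom m y X) ≡ _) (sym found)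
           (from (take-greedy⇔Matches γs γ y X) matches)))

Matches-ascending : ∀ X j y γs → Matches X j y γs → Linked _<_ (j ∷ γs)
Matches-ascending X j y       []       _                 = [-]
Matches-ascending X j (b ∷ y) (γ ∷ γs) (found , matches) =
  scan-≥ (suc j) b (drop j X) found ∷ Matches-ascending X γ y γs matches

Matches-≤-retained : ∀ X j y γs ts → Matches X j y γs → Prefix (λ b t → BitAt 1 X t b) y ts →
                     Linked _<_ (j ∷ ts) → Prefix _≤_ γs ts
Matches-≤-retained X j y       []       ts       _                 _        _ = []
Matches-≤-retained X j (b ∷ y) (γ ∷ γs) (t ∷ ts) (found , matches) (a ∷ as) (j<t ∷ ascending) =
  γ≤t ∷ Matches-≤-retained X γ y γs ts matches as (Linked-<-lowerHead γ≤t ascending)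
  where γ≤t = firstAfter-least j b X found a j<t

Prefix-take-toList : ∀ {A B : Set} {R : A → B → Set} {k} (v : Vec A k) {bs} →
                     Prefix R (toList v) bs → Prefix R (toList v) (take k bs)
Prefix-take-toList Vec.[]       _        = []
Prefix-take-toList (a Vec.∷ v) (r ∷ rs) = r ∷ Prefix-take-toList v rs

ascending-≤-last : ∀ {k} (v : Vec ℕ (suc k)) → Linked _<_ (toList v) → All (_≤ last v) (toList v)
ascending-≤-last (x Vec.∷ Vec.[])     [-]              = ≤-refl ∷ []
ascending-≤-last (x Vec.∷ y Vec.∷ v) (x<y ∷ ascending) =
  ≤-trans (<⇒≤ x<y) (All.head rest) ∷ rest
  where rest = ascending-≤-last (y Vec.∷ v) ascending

-- The toggling mask

BlockConstant : (ℕ → Bool) → ℕ → List ℕ → List ℕ → Set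
BlockConstant M j []       _        = ⊤
BlockConstant M j (γ ∷ γs) []       = ⊥
BlockConstant M j (γ ∷ γs) (t ∷ ts) = (∀ p → j < p → p ≤ γ → M p ≡ M t) × BlockConstant M γ γs ts

BlockConstant-cong : ∀ {M M′ j γs ts} → (∀ p → j < p → M p ≡ M′ p) →
  Linked _<_ (j ∷ γs) → Prefix _≤_ γs ts → BlockConstant M′ j γs ts → BlockConstant M j γs ts
BlockConstant-cong {γs = []}     agree _                 _           _ = tt
BlockConstant-cong {γs = γ ∷ γs} agree (j<γ ∷ ascending) (γ≤t ∷ le) (constant , rest) =
  (λ p j<p p≤γ → trans (agree p j<p)
                        (trans (constant p j<p p≤γ) (sym (agree _ (<-≤-trans j<γ γ≤t))))) ,
  BlockConstant-cong (λ p γ<p → agree p (<-trans j<γ γ<p)) ascending le rest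

BlockConstant-take : ∀ {M j k} (γ : Vec ℕ k) ts →
                     BlockConstant M j (toList γ) (take k ts) → BlockConstant M j (toList γ) ts
BlockConstant-take Vec.[]       ts       _                = tt
BlockConstant-take (γ Vec.∷ v) (t ∷ ts) (constant , rest) = constant , BlockConstant-take v ts rest

redirect : ℕ → ℕ → ℕ → ℕ
redirect γ t p = if does (p ≤? γ) then t else p

redirect-≤ : ∀ {γ} t {p} → p ≤ γ → redirect γ t p ≡ t
redirect-≤ t {p} p≤γ = cong (if_then t else p) (dec-true (p ≤? _) p≤γ)

redirect-> : ∀ {γ} t {p} → γ < p → redirect γ t p ≡ p
redirect-> t {p} γ<p = cong (if_then t else p) (dec-false (p ≤? _) (<⇒≱ γ<p))

redirect-target : ∀ γ t → redirect γ t t ≡ t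
redirect-target γ t = if-eta (does (t ≤? γ))

-- Every p ≤ γ (the first block) is redirected to t, and t stays where it is, so composing
-- the redirections of all blocks makes the mask constant on each block.
mask : List ℕ → List ℕ → (ℕ → Bool) → ℕ → Bool
mask (γ ∷ γs) (t ∷ ts) base p = mask γs ts base (redirect γ t p)
mask []       _        base p = base p
mask (γ ∷ γs) []       base p = base p

mask-blockConstant : ∀ base {j γs ts} → Linked _<_ (j ∷ γs) → Prefix _≤_ γs ts →
                     BlockConstant (mask γs ts base) j γs ts
mask-blockConstant base {γs = []}               _                 _          = tt
mask-blockConstant base {γs = γ ∷ γs} {t ∷ ts} (j<γ ∷ ascending) (γ≤t ∷ le) =
  (λ p _ p≤γ → cong (mask γs ts base) (trans (redirect-≤ t p≤γ) (sym (redirect-target γ t)))) ,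
  BlockConstant-cong (λ p γ<p → cong (mask γs ts base) (redirect-> t γ<p))
                     ascending le (mask-blockConstant base ascending le)

mask-beyond : ∀ base {γs ts p} → All (_< p) γs → mask γs ts base p ≡ base p
mask-beyond base {[]}               _            = refl
mask-beyond base {γ ∷ γs} {[]}      _            = refl
mask-beyond base {γ ∷ γs} {t ∷ ts} (γ<p ∷ γs<p) =
  trans (cong (mask γs ts base) (redirect-> t γ<p)) (mask-beyond base γs<p)

Matches-toggle : ∀ M X j y γs ts → Matches X j y γs → BlockConstant M j γs ts →
                 Matches (toggle M 1 X) j (zipWith _xor_ y (map M ts)) γs
Matches-toggle M X j y       []       ts       _                 _                 = tt
Matches-toggle M X j (b ∷ y) (γ ∷ γs) (t ∷ ts) (found , matches) (constant , rest) =
  firstAfter-toggle M (M t) j b X found constant , Matches-toggle M X γ y γs ts matches rest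

module _ {n k : ℕ} (τ γ : Vec ℕ (suc k)) {x r : Vec Bool n} (cond : Cond τ γ x r) where

  private
    X = toList x
    R = toList r

  Cond⇒Matches : Matches X 0 (traceBits X R) (toList γ)
  Cond⇒Matches = to (take-greedy⇔Matches γ 0 (traceBits X R) X) (proj₂ (proj₂ cond))

  Cond⇒≤last : All (_≤ last γ) (toList γ)
  Cond⇒≤last = ascending-≤-last γ (Linked.tail (Matches-ascending X 0 _ _ Cond⇒Matches))

  Cond-toggle : ∀ base → Cond τ γ (toggleᵛ (mask (toList γ) (toList τ) base) 1 x) r
  Cond-toggle base = enough-retained , t≡τ , greedy-toggled
    where
    enough-retained = proj₁ cond
    t≡τ = proj₁ (proj₂ cond)
    M = mask (toList γ) (toList τ) base
    y = traceBits X R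
    T = tIdx R
    γ≤τ : Prefix _≤_ (toList γ) (toList τ)
    γ≤τ = subst (Prefix _≤_ (toList γ)) t≡τ (Prefix-take-toList γ
            (Matches-≤-retained X 0 y (toList γ) T Cond⇒Matches
                                (trace-BitAt 1 X R) (retained-ascending 0 R)))
    constant : BlockConstant M 0 (toList γ) T
    constant = BlockConstant-take γ T (subst (BlockConstant M 0 (toList γ)) (sym t≡τ)
                 (mask-blockConstant base (Matches-ascending X 0 y (toList γ) Cond⇒Matches) γ≤τ))
    greedy-toggled : take (suc k) (g (traceBits (toList (toggleᵛ M 1 x)) R) (toList (toggleᵛ M 1 x)))
                   ≡ map just (toList γ)
    greedy-toggled rewrite toList-toggleᵛ M 1 x | traceBits-toggle M 1 X R =
      from (take-greedy⇔Matches γ 0 _ _) (Matches-toggle M X 0 y (toList γ) T Cond⇒Matches constant)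

-- The suffix, one bit at a time

module _ (n : ℕ) {k : ℕ} (τ γ : Vec ℕ (suc k)) (s : Vec Bool (n ∸ last γ)) where

  private
    L = last γ
    m = n ∸ L

  suffix : Vec Bool n → List Bool
  suffix x = drop L (toList x)

  length-suffix : ∀ x → length (suffix x) ≡ m
  length-suffix x = trans (List.length-drop L (toList x)) (cong (_∸ L) (length-toList x))

  AgreeUpTo : ℕ → Vec Bool n → Vec Bool n → Set
  AgreeUpTo j x r = Cond τ γ x r × take j (suffix x) ≡ take j (toList s)

  AgreeUpTo? : ∀ j x r → Dec (AgreeUpTo j x r)
  AgreeUpTo? j x r = Cond? τ γ x r ×-dec List.≡-dec _≟ᵇ_ (take j (suffix x)) (take j (toList s))

  CondSuffix⇔AgreeUpTo : ∀ x r → CondSuffix τ γ L (toList s) x r ⇔ AgreeUpTo m x r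
  CondSuffix⇔AgreeUpTo x r = mk⇔
    (λ (cond , eq) → cond , cong (take m) eq)
    (λ (cond , eq) → cond , trans (sym (List.take-all m (suffix x) (≤-reflexive (length-suffix x))))
                                  (trans eq (List.take-all m (toList s) (≤-reflexive (length-toList s)))))

  suffix-toggle : ∀ M x → suffix (toggleᵛ M 1 x) ≡ toggle M (suc L) (suffix x)
  suffix-toggle M x = trans (cong (drop L) (toList-toggleᵛ M 1 x)) (drop-toggle M L 1 (toList x))

  AgreeUpTo-suc⇔ : ∀ j → j < m → ∀ x r →
    AgreeUpTo (suc j) x r ⇔ (AgreeUpTo j x r × bitAt j (suffix x) ≡ bitAt j (toList s))
  AgreeUpTo-suc⇔ j j<m x r = mk⇔
    (λ (cond , eq) → let eq₁ , eq₂ = to next eq in (cond , eq₁) , eq₂)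
    (λ ((cond , eq₁) , eq₂) → cond , from next (eq₁ , eq₂))
    where
    next : take (suc j) (suffix x) ≡ take (suc j) (toList s)
         ⇔ (take j (suffix x) ≡ take j (toList s) × bitAt j (suffix x) ≡ bitAt j (toList s))
    next = take-suc-≡ j (suffix x) (toList s)
             (subst (j <_) (sym (length-suffix x)) j<m) (subst (j <_) (sym (length-toList s)) j<m)

  -- X's index j + suc L holds suffix bit j (counting from 0).
  flipMask : ℕ → ℕ → Bool
  flipMask j = mask (toList γ) (toList τ) (λ q → does (q ≟ℕ j + suc L))

  flipMask-beyond : ∀ j {x r : Vec Bool n} {q} → Cond τ γ x r → L < q →
                    flipMask j q ≡ does (q ≟ℕ j + suc L)
  flipMask-beyond j cond L<q =
    mask-beyond _ (All.map (λ γ≤L → ≤-<-trans γ≤L L<q) (Cond⇒≤last τ γ cond))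

  AgreeUpTo-toggle : ∀ j {x r : Vec Bool n} →
                     AgreeUpTo j x r → AgreeUpTo j (toggleᵛ (flipMask j) 1 x) r
  AgreeUpTo-toggle j {x} (cond , agree) =
    Cond-toggle τ γ cond _ ,
    trans (cong (take j) (suffix-toggle (flipMask j) x))
          (trans (take-toggle (flipMask j) j (suc L) (suffix x) off) agree)
    where
    off : ∀ d → d < j → flipMask j (d + suc L) ≡ false
    off d d<j = trans (flipMask-beyond j cond (m≤n+m (suc L) d))
                      (dec-false (d + suc L ≟ℕ j + suc L)
                                 (λ eq → <-irrefl (+-cancelʳ-≡ (suc L) d j eq) d<j))

  suffix-bit-toggle : ∀ j → j < m → ∀ {x r : Vec Bool n} → Cond τ γ x r →
    bitAt j (suffix (toggleᵛ (flipMask j) 1 x)) ≡ not (bitAt j (suffix x))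
  suffix-bit-toggle j j<m {x} cond = begin
    bitAt j (suffix (toggleᵛ (flipMask j) 1 x))
      ≡⟨ cong (bitAt j) (suffix-toggle (flipMask j) x) ⟩
    bitAt j (toggle (flipMask j) (suc L) (suffix x))
      ≡⟨ bitAt-toggle (flipMask j) j (suc L) (suffix x) (subst (j <_) (sym (length-suffix x)) j<m) ⟩
    bitAt j (suffix x) xor flipMask j (j + suc L)
      ≡⟨ cong (bitAt j (suffix x) xor_)
              (trans (flipMask-beyond j cond (m≤n+m (suc L) j))
                     (dec-true (j + suc L ≟ℕ j + suc L) refl)) ⟩
    bitAt j (suffix x) xor true
      ≡⟨ xor-comm (bitAt j (suffix x)) true ⟩
    not (bitAt j (suffix x)) ∎
    where open ≡-Reasoning

  module _ (p : ℚ) where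

    AgreeUpTo-halves : ∀ j → j < m →
      Pr p n (AgreeUpTo (suc j)) (AgreeUpTo? (suc j)) ≡ ½ * Pr p n (AgreeUpTo j) (AgreeUpTo? j)
    AgreeUpTo-halves j j<m = begin
      Pr p n (AgreeUpTo (suc j)) (AgreeUpTo? (suc j))
        ≡⟨ Pr-cong (AgreeUpTo? (suc j)) bit-agrees? (AgreeUpTo-suc⇔ j j<m) ⟩
      Pr p n (λ x r → AgreeUpTo j x r × β x ≡ bitAt j (toList s)) bit-agrees?
        ≡⟨ Pr-fair-bit (flipMask j) (AgreeUpTo? j) β (bitAt j (toList s))
                       (AgreeUpTo-toggle j) (λ (cond , _) → suffix-bit-toggle j j<m cond) ⟩
      ½ * Pr p n (AgreeUpTo j) (AgreeUpTo? j) ∎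
      where
      open ≡-Reasoning
      β : Vec Bool n → Bool
      β x = bitAt j (suffix x)
      bit-agrees? : ∀ x r → Dec (AgreeUpTo j x r × β x ≡ bitAt j (toList s))
      bit-agrees? x r = AgreeUpTo? j x r ×-dec (β x ≟ᵇ bitAt j (toList s))

    AgreeUpTo-probability : ∀ j → j ≤ m →
      Pr p n (AgreeUpTo j) (AgreeUpTo? j) ≡ halfPow j * Pr p n (Cond τ γ) (Cond? τ γ)
    AgreeUpTo-probability zero    _   =
      trans (Pr-cong (AgreeUpTo? 0) (Cond? τ γ) (λ x r → mk⇔ proj₁ (_, refl))) (sym (ℚ.*-identityˡ _))
    AgreeUpTo-probability (suc j) j<m =
      trans (AgreeUpTo-halves j j<m)
            (trans (cong (½ *_) (AgreeUpTo-probability j (<⇒≤ j<m))) (sym (ℚ.*-assoc ½ (halfPow j) _)))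

lemma2p2 : (p : ℚ) → 0ℚ <ℚ p → p <ℚ 1ℚ → (n k : ℕ) →
    (τ γ : Vec ℕ (suc k)) → (s : Vec Bool (n ∸ last γ)) →
    Pr p n (CondSuffix τ γ (last γ) (toList s)) (CondSuffix? τ γ (last γ) (toList s))
    ≡ halfPow (n ∸ last γ) * Pr p n (Cond τ γ) (Cond? τ γ)
lemma2p2 p _ _ n k τ γ s = begin
  Pr p n (CondSuffix τ γ (last γ) (toList s)) (CondSuffix? τ γ (last γ) (toList s))
    ≡⟨ Pr-cong (CondSuffix? τ γ (last γ) (toList s)) (AgreeUpTo? n τ γ s (n ∸ last γ))
               (CondSuffix⇔AgreeUpTo n τ γ s) ⟩
  Pr p n (AgreeUpTo n τ γ s (n ∸ last γ)) (AgreeUpTo? n τ γ s (n ∸ last γ))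
    ≡⟨ AgreeUpTo-probability n τ γ s p (n ∸ last γ) ≤-refl ⟩
  halfPow (n ∸ last γ) * Pr p n (Cond τ γ) (Cond? τ γ) ∎
  where open ≡-Reasoning
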